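{- In the Slow Flashcard Game: (i) for all $n,k\ge1$ we have $\dfrac{n}{\sqrt{T_n(k)}}+\dfrac{k}{\sqrt{T_n(k)}}>1$; (ii) for every $\varepsilon>0$ there exists $M$ such that for all $n,k\ge1$ with $T_n(k)\ge M$ we have $\left(\dfrac{n}{\sqrt{T_n(k)}}\right)^2+\left(\dfrac{k}{\sqrt{T_n(k)}}\right)^2<2+\varepsilon$.
   Context: The Slow Flashcard Game is the following deterministic process with insertion sequence $p_k=k+1$. The state at each time $t=1,2,\dots$ consists of an ordering (the deck) of all positive integers (cards), positions numbered $1,2,\dots$ from the front, together with a counter for each card recording how many times it has been seen. At time $t=1$ the deck is $1,2,3,\dots$, card $1$ (at the front) has been seen once, and all other cards $0$ times. To pass from time $t$ to $t+1$: if the front card has been seen $k$ times so far, remove it and reinsert it so that it occupies position $k+1$; then the card now at the front has its counter increased by one (it is seen at time $t+1$). For $n,k\ge1$, $T_n(k)$ denotes the time at which card $n$ is seen for the $k$-th time.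
   Formalization: In part (ii), the tolerance ε ranges over the positive rationals. -}

module Defs where

open import Data.Nat using (ℕ; zero; suc; _+_; _*_; _∸_; _<ᵇ_; _≡ᵇ_)
open import Data.Bool using (if_then_else_)
open import Data.Integer using (+_)
open import Data.Rational using (ℚ; _/_)
open import Data.Product using (_×_)
open import Relation.Binary.PropositionalEquality using (_≡_)

-- A state of the Slow Flashcard Game (insertion sequence p_k = k + 1).
-- deck i  = the card at position i + 1 (positions are 0-indexed here).
-- count c = number of times card c has been seen so far.
record State : Set where
  field
    deck  : ℕ → ℕ
    count : ℕ → ℕ
open State public

initial : State
initial = record
  { deck  = λ i → suc i
  ; count = λ c → if c ≡ᵇ 1 then 1 else 0 }

-- One step: front card c, seen k times, is removed and reinserted so that
-- it occupies position k + 1 (index k); then the new front card is seen.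
step : State → State
step s = record { deck = d' ; count = cnt' }
  where
  c : ℕ
  c = deck s 0
  k : ℕ
  k = count s c
  d' : ℕ → ℕ
  d' i = if i <ᵇ k then deck s (suc i) else (if i ≡ᵇ k then c else deck s i)
  cnt' : ℕ → ℕ
  cnt' x = if x ≡ᵇ d' 0 then suc (count s x) else count s x

-- stateAt i = the state at time t = i + 1.
stateAt : ℕ → State
stateAt zero    = initial
stateAt (suc i) = step (stateAt i)

-- Card n is seen for the k-th time at time t (t ≥ 1), i.e. T_n(k) = t.
SeenAt : ℕ → ℕ → ℕ → Set
SeenAt n k t = deck (stateAt (t ∸ 1)) 0 ≡ n × count (stateAt (t ∸ 1)) n ≡ k

ℕ→ℚ : ℕ → ℚ
ℕ→ℚ n = + n / 1

-- Let m be the largest card seen so far. Every seen card x has x + count x ≥ m, the front card even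
-- x + count x > m, and no count exceeds m; since the time is the sum of all counts, card n seen for
-- the k-th time at time t gives t ≤ m² < (n + k)².  For (ii) we carry n² + k² + k ≤ 2t + n for the
-- front card, and for each waiting card the same inequality at the earliest time it can return to
-- the front.  A new card m + 1 reaches the front only when every x ≤ m has x + count x > m, so at
-- that time t ≥ Σ (m + 1 − x) = m(m + 1)/2, which starts it off.  Thus n = O(√t) and
-- n² + k² ≤ 2t + n < (2 + ε)t once t is large.

module Submission where

open import Defs
open import Data.Nat using (ℕ; _+_; _*_; _<_; _≥_)
open import Data.Rational using (ℚ; 0ℚ) renaming (_<_ to _<ℚ_; _+_ to _+ℚ_; _*_ to _*ℚ_)
open import Data.Product using (_×_; ∃)

open import Data.Bool using (true; false; T; if_then_else_)
open import Data.Bool.Properties using (if-float)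
open import Data.Empty using (⊥-elim)
open import Data.List using ([]; _∷_)
open import Data.Nat using (zero; suc; _≤_; _<ᵇ_; _≡ᵇ_; z≤n; s≤s; _≟_; _<?_; >-nonZero)
open import Data.Nat.Properties
open import Data.Nat.Coprimality using (Coprime; 1-coprimeTo)
import Data.Nat.Coprimality as Coprime
open import Data.Nat.Tactic.RingSolver using (solve)
open import Data.Integer as ℤ using (-[1+_]; +<+)
import Data.Integer.Properties as ℤₚ
open import Data.Rational using (mkℚ; toℚᵘ; *<*)
import Data.Rational.Properties as ℚₚ
open import Data.Rational.Unnormalised as ℚᵘ using (mkℚᵘ)
import Data.Rational.Unnormalised.Properties as ℚᵘₚ
open import Data.Product using (_,_; proj₁; proj₂)
open import Data.Sum using (inj₁; inj₂)
open import Function using (_∘_)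
open import Relation.Binary using (tri<; tri≈; tri>)
open import Relation.Binary.PropositionalEquality
open import Relation.Nullary using (¬_; yes; no)

if-true : ∀ {A : Set} {b} {x y : A} → T b → (if b then x else y) ≡ x
if-true {b = true} _ = refl

if-false : ∀ {A : Set} {b} {x y : A} → ¬ T b → (if b then x else y) ≡ y
if-false {b = false} _  = refl
if-false {b = true}  ¬t = ⊥-elim (¬t _)

source : ℕ → ℕ → ℕ
source k i = if i <ᵇ k then suc i else (if i ≡ᵇ k then 0 else i)

source-< : ∀ {k i} → i < k → source k i ≡ suc i
source-< i<k = if-true (<⇒<ᵇ i<k)

source-≡ : ∀ k → source k k ≡ 0
source-≡ k = trans (if-false (<-irrefl refl ∘ <ᵇ⇒< k k)) (if-true (≡⇒≡ᵇ k k refl))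

source-> : ∀ {k i} → k < i → source k i ≡ i
source-> {k} {i} k<i = trans (if-false (<⇒≯ k<i ∘ <ᵇ⇒< i k)) (if-false (<⇒≢ k<i ∘ sym ∘ ≡ᵇ⇒≡ i k))

data SourceView (k i : ℕ) : Set where
  shifted    : i < k → source k i ≡ suc i → SourceView k i
  reinserted : i ≡ k → source k i ≡ 0     → SourceView k i
  unmoved    : k < i → source k i ≡ i     → SourceView k i

sourceView : ∀ k i → SourceView k i
sourceView k i with <-cmp i k
... | tri< i<k _ _  = shifted i<k (source-< i<k)
... | tri≈ _ refl _ = reinserted refl (source-≡ k)
... | tri> _ _ k<i  = unmoved k<i (source-> k<i)

target : ℕ → ℕ → ℕ
target k zero = k
target k (suc j) with j <? k
... | yes _ = j
... | no _  = suc j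

target-< : ∀ {k j} → j < k → target k (suc j) ≡ j
target-< {k} {j} j<k with j <? k
... | yes _  = refl
... | no j≮k = ⊥-elim (j≮k j<k)

target-> : ∀ {k i} → k < i → target k i ≡ i
target-> {k} {suc j} (s≤s k≤j) with j <? k
... | yes j<k = ⊥-elim (<⇒≱ j<k k≤j)
... | no _    = refl

target-source : ∀ k i → target k (source k i) ≡ i
target-source k i with sourceView k i
... | shifted i<k e    rewrite e = target-< i<k
... | reinserted refl e rewrite e = refl
... | unmoved k<i e    rewrite e = target-> k<i

source-injective : ∀ k {i j} → source k i ≡ source k j → i ≡ j
source-injective k {i} {j} e =
  trans (sym (target-source k i)) (trans (cong (target k) e) (target-source k j))

source-target : ∀ k j → source k (target k j) ≡ j
source-target k zero = source-≡ k
source-target k (suc j) with j <? k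
... | yes j<k = source-< j<k
... | no j≮k  = source-> (s≤s (≮⇒≥ j≮k))

source-bounded : ∀ {k i m} → i ≤ m → k ≤ m → source k i ≤ m
source-bounded {k} {i} i≤m k≤m with sourceView k i
... | shifted i<k e     rewrite e = ≤-trans i<k k≤m
... | reinserted _ e    rewrite e = z≤n
... | unmoved _ e       rewrite e = i≤m

target-bounded : ∀ {k j m} → j ≤ m → k ≤ m → target k j ≤ m
target-bounded {k} {zero}  _   k≤m = k≤m
target-bounded {k} {suc j} j<m _ with j <? k
... | yes _ = ≤-trans (n≤1+n j) j<m
... | no _  = j<m

source-pos : ∀ {k i} → 1 ≤ i → i ≢ k → 1 ≤ source k i
source-pos {k} {i} 1≤i i≢k with sourceView k i
... | shifted _ e      rewrite e = s≤s z≤n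
... | reinserted i≡k _ = ⊥-elim (i≢k i≡k)
... | unmoved _ e      rewrite e = 1≤i

target-≤ : ∀ k {p} → 1 ≤ p → target k p ≤ p
target-≤ k {suc p} _ with p <? k
... | yes _ = n≤1+n p
... | no _  = ≤-refl

target-pos : ∀ k {p} → 2 ≤ p → 1 ≤ target k p
target-pos k {suc (suc p)} (s≤s (s≤s z≤n)) with suc p <? k
... | yes _ = s≤s z≤n
... | no _  = s≤s z≤n

target-mono : ∀ k {j p} → 1 ≤ j → j < p → target k j < target k p
target-mono k {suc j} {suc p} _ (s≤s j<p) with j <? k | p <? k
... | yes _  | yes _   = j<p
... | yes _  | no _    = ≤-trans j<p (n≤1+n p)
... | no j≮k | yes p<k = ⊥-elim (j≮k (<-trans j<p p<k))
... | no _   | no _    = s≤s j<p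

≤-target⇒< : ∀ k {p} → 1 ≤ p → k ≤ target k p → k < p
≤-target⇒< k {suc p} _ k≤ with p <? k
... | yes _  = s≤s k≤
... | no p≮k = s≤s (≮⇒≥ p≮k)

<-target⇒< : ∀ k {p i} → 1 ≤ p → i < k → i ≤ target k p → i < p
<-target⇒< k {suc p} _ i<k i≤ with p <? k
... | yes _  = s≤s i≤
... | no p≮k = <-≤-trans i<k (≤-trans (≮⇒≥ p≮k) (n≤1+n p))

≤-target⇒source≤ : ∀ k {p i} → 1 ≤ p → i ≤ target k p → i ≢ k → source k i ≤ p
≤-target⇒source≤ k {p} {i} 1≤p i≤ i≢k with sourceView k i
... | shifted i<k e    rewrite e = <-target⇒< k 1≤p i<k i≤
... | reinserted i≡k _ = ⊥-elim (i≢k i≡k)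
... | unmoved _ e      rewrite e = ≤-trans i≤ (target-≤ k 1≤p)

frontCount : State → ℕ
frontCount s = count s (deck s 0)

deck-step : ∀ s i → deck (step s) i ≡ deck s (source (frontCount s) i)
deck-step s i = sym (trans (if-float (deck s) (i <ᵇ k))
  (cong (if i <ᵇ k then deck s (suc i) else_) (if-float (deck s) (i ≡ᵇ k))))
  where k = frontCount s

count-step-front : ∀ s → count (step s) (deck (step s) 0) ≡ suc (count s (deck (step s) 0))
count-step-front s = if-true (≡⇒≡ᵇ (deck (step s) 0) _ refl)

count-step-other : ∀ s {x} → x ≢ deck (step s) 0 → count (step s) x ≡ count s x
count-step-other s {x} x≢ = if-false (x≢ ∘ ≡ᵇ⇒≡ x _)

count-step-≥ : ∀ s x → count s x ≤ count (step s) x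
count-step-≥ s x with x ≟ deck (step s) 0
... | yes refl = ≤-trans (n≤1+n _) (≤-reflexive (sym (count-step-front s)))
... | no x≢    = ≤-reflexive (sym (count-step-other s x≢))

count-step-≤ : ∀ s x → count (step s) x ≤ suc (count s x)
count-step-≤ s x with x ≟ deck (step s) 0
... | yes refl = ≤-reflexive (count-step-front s)
... | no x≢    = ≤-trans (≤-reflexive (count-step-other s x≢)) (n≤1+n _)

deck-step-target : ∀ s j → deck (step s) (target (frontCount s) j) ≡ deck s j
deck-step-target s j = trans (deck-step s _) (cong (deck s) (source-target (frontCount s) j))

deck-step-injective : ∀ s {i j} → (∀ {i j} → deck s i ≡ deck s j → i ≡ j) →
                      deck (step s) i ≡ deck (step s) j → i ≡ j
deck-step-injective s {i} {j} inj e =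
  source-injective (frontCount s) (inj (trans (sym (deck-step s i)) (trans e (deck-step s j))))

sumTo : ℕ → (ℕ → ℕ) → ℕ
sumTo zero    f = 0
sumTo (suc m) f = sumTo m f + f (suc m)

sumTo-cong : ∀ m {f g : ℕ → ℕ} → (∀ x → 1 ≤ x → x ≤ m → f x ≡ g x) → sumTo m f ≡ sumTo m g
sumTo-cong zero    f≡g = refl
sumTo-cong (suc m) f≡g =
  cong₂ _+_ (sumTo-cong m (λ x 1≤x x≤m → f≡g x 1≤x (≤-trans x≤m (n≤1+n m))))
            (f≡g (suc m) (s≤s z≤n) ≤-refl)

sumTo-increment : ∀ m {f g : ℕ → ℕ} {y} → 1 ≤ y → y ≤ m →
                  g y ≡ suc (f y) → (∀ x → x ≢ y → g x ≡ f x) → sumTo m g ≡ suc (sumTo m f)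
sumTo-increment zero    (s≤s z≤n) () _ _
sumTo-increment (suc m) {f} {g} {y} 1≤y y≤m gy gx with y ≟ suc m
... | yes refl = begin
  sumTo m g + g (suc m)       ≡⟨ cong₂ _+_ (sumTo-cong m (λ x _ x≤m → gx x (<⇒≢ (s≤s x≤m)))) gy ⟩
  sumTo m f + suc (f (suc m)) ≡⟨ +-suc _ _ ⟩
  suc (sumTo m f + f (suc m)) ∎
  where open ≡-Reasoning
... | no y≢ = cong₂ _+_ (sumTo-increment m 1≤y (≤-pred (≤∧≢⇒< y≤m y≢)) gy gx) (gx (suc m) (y≢ ∘ sym))

sumTo-≤ : ∀ m {f : ℕ → ℕ} {B} → (∀ x → f x ≤ B) → sumTo m f ≤ m * B
sumTo-≤ zero    f≤B = z≤n
sumTo-≤ (suc m) {f} {B} f≤B = begin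
  sumTo m f + f (suc m) ≤⟨ +-mono-≤ (sumTo-≤ m f≤B) (f≤B (suc m)) ⟩
  m * B + B             ≡⟨ +-comm (m * B) B ⟩
  suc m * B             ∎
  where open ≤-Reasoning

sumTo-≥ : ∀ m {f : ℕ → ℕ} {K} → (∀ x → 1 ≤ x → x ≤ m → K ≤ f x + x) →
          2 * K * m ≤ 2 * sumTo m f + m * suc m
sumTo-≥ zero    {f} {K} _   = ≤-reflexive (*-zeroʳ (2 * K))
sumTo-≥ (suc m) {f} {K} K≤ = begin
  2 * K * suc m
    ≡⟨ solve (K ∷ m ∷ []) ⟩
  2 * K * m + 2 * K
    ≤⟨ +-mono-≤ (sumTo-≥ m K≤′) (*-monoʳ-≤ 2 (K≤ (suc m) (s≤s z≤n) ≤-refl)) ⟩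
  2 * sumTo m f + m * suc m + 2 * (f (suc m) + suc m)
    ≡⟨ regroup (sumTo m f) (f (suc m)) ⟩
  2 * (sumTo m f + f (suc m)) + suc m * suc (suc m) ∎
  where
  open ≤-Reasoning
  regroup : ∀ S y → 2 * S + m * suc m + 2 * (y + suc m) ≡ 2 * (S + y) + suc m * suc (suc m)
  regroup S y = solve (S ∷ y ∷ m ∷ [])
  K≤′ : ∀ x → 1 ≤ x → x ≤ m → K ≤ f x + x
  K≤′ x 1≤x x≤m = K≤ x 1≤x (≤-trans x≤m (n≤1+n m))

record Arrangement (d : ℕ → ℕ) (m : ℕ) : Set where
  field
    beyond    : ∀ i → m < i → d i ≡ suc i
    bounded   : ∀ i → i ≤ m → 1 ≤ d i × d i ≤ suc m
    injective : ∀ {i j} → d i ≡ d j → i ≡ j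
    onto      : ∀ x → 1 ≤ x → x ≤ suc m → ∃ λ i → i ≤ m × d i ≡ x

arrangement-initial : Arrangement (deck initial) 1
arrangement-initial = record
  { beyond    = λ _ _ → refl
  ; bounded   = λ i i≤1 → s≤s z≤n , s≤s i≤1
  ; injective = suc-injective
  ; onto      = λ { (suc x) _ (s≤s x≤1) → x , x≤1 , refl }
  }

arrangement-suc : ∀ {d m} → Arrangement d m → Arrangement d (suc m)
arrangement-suc {d} {m} A = record
  { beyond    = λ i m+1<i → beyond i (<-trans (n<1+n m) m+1<i)
  ; bounded   = bounded′
  ; injective = injective
  ; onto      = onto′
  }
  where
  open Arrangement A
  bounded′ : ∀ i → i ≤ suc m → 1 ≤ d i × d i ≤ suc (suc m)
  bounded′ i i≤m+1 with m≤n⇒m<n∨m≡n i≤m+1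
  ... | inj₁ i≤m = let (1≤di , di≤m+1) = bounded i (≤-pred i≤m) in 1≤di , ≤-trans di≤m+1 (n≤1+n _)
  ... | inj₂ refl = subst (λ x → 1 ≤ x × x ≤ suc (suc m)) (sym (beyond (suc m) ≤-refl)) (s≤s z≤n , ≤-refl)
  onto′ : ∀ x → 1 ≤ x → x ≤ suc (suc m) → ∃ λ i → i ≤ suc m × d i ≡ x
  onto′ x 1≤x x≤m+2 with m≤n⇒m<n∨m≡n x≤m+2
  ... | inj₁ x≤m+1 = let (i , i≤m , di≡x) = onto x 1≤x (≤-pred x≤m+1) in
                     i , ≤-trans i≤m (n≤1+n m) , di≡x
  ... | inj₂ refl = suc m , ≤-refl , beyond (suc m) ≤-refl

arrangement-step : ∀ {s m} → Arrangement (deck s) m → frontCount s ≤ m → Arrangement (deck (step s)) m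
arrangement-step {s} {m} A k≤m = record
  { beyond    = λ i m<i → trans (deck-step s i) (trans (cong (deck s) (source-> (≤-<-trans k≤m m<i))) (beyond i m<i))
  ; bounded   = λ i i≤m → subst (λ x → 1 ≤ x × x ≤ suc m) (sym (deck-step s i))
                                  (bounded _ (source-bounded i≤m k≤m))
  ; injective = deck-step-injective s injective
  ; onto      = λ x 1≤x x≤m+1 → let (j , j≤m , dj≡x) = onto x 1≤x x≤m+1 in
                  target (frontCount s) j , target-bounded j≤m k≤m , trans (deck-step-target s j) dj≡x
  }
  where open Arrangement A

SeenBound : ℕ → ℕ → ℕ → Set
SeenBound n k t = n * n + k * k + k ≤ 2 * t + n

seenBound-mono : ∀ {n k t t′} → t ≤ t′ → SeenBound n k t → SeenBound n k t′
seenBound-mono {n} t≤t′ b = ≤-trans b (+-monoˡ-≤ n (*-monoʳ-≤ 2 t≤t′))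

seenBound-next : ∀ {n k t} → SeenBound n k t → SeenBound n (suc k) (t + suc k)
seenBound-next {n} {k} {t} b = begin
  n * n + suc k * suc k + suc k ≡⟨ solve (n ∷ k ∷ []) ⟩
  (n * n + k * k + k) + 2 * suc k ≤⟨ +-monoˡ-≤ _ b ⟩
  (2 * t + n) + 2 * suc k       ≡⟨ solve (t ∷ n ∷ k ∷ []) ⟩
  2 * (t + suc k) + n           ∎
  where open ≤-Reasoning

seenBound-first : ∀ {m t} → m * suc m ≤ 2 * t → SeenBound (suc m) 1 (suc t)
seenBound-first {m} {t} m[m+1]≤2t = begin
  suc m * suc m + 1 * 1 + 1 ≡⟨ solve (m ∷ []) ⟩
  m * suc m + (m + 3)       ≤⟨ +-monoˡ-≤ _ m[m+1]≤2t ⟩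
  2 * t + (m + 3)           ≡⟨ solve (t ∷ m ∷ []) ⟩
  2 * suc t + suc m         ∎
  where open ≤-Reasoning

-- The state s at time t: the cards seen so far are 1..m, and the unseen card m + 1 lies at position
-- newPos.  A card at position i ≥ 1 cannot be back at the front before time t + i.
record Invariant (s : State) (m t : ℕ) : Set where
  field
    arranged     : Arrangement (deck s) m
    newPos       : ℕ
    1≤newPos     : 1 ≤ newPos
    newPos≤m     : newPos ≤ m
    deck-newPos  : deck s newPos ≡ suc m
    unseen       : ∀ x → m < x → count s x ≡ 0
    count≤m      : ∀ x → count s x ≤ m
    count<m      : ∀ i → 1 ≤ i → i ≤ newPos → count s (deck s i) < m
    seen         : ∀ x → 1 ≤ x → x ≤ m → 1 ≤ count s x
    m≤card+count : ∀ x → 1 ≤ x → x ≤ m → m ≤ x + count s x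
    tight-ahead  : ∀ x → 1 ≤ x → x ≤ m → x + count s x ≡ m → ∃ λ i → i < newPos × deck s i ≡ x
    front-loose  : suc m ≤ deck s 0 + frontCount s
    total        : sumTo m (count s) ≡ t
    front-bound  : SeenBound (deck s 0) (frontCount s) t
    queue-bound  : ∀ i → 1 ≤ i → 1 ≤ count s (deck s i) →
                   SeenBound (deck s i) (suc (count s (deck s i))) (t + i)

invariant-initial : Invariant initial 1 1
invariant-initial = record
  { arranged     = arrangement-initial
  ; newPos       = 1
  ; 1≤newPos     = ≤-refl
  ; newPos≤m     = ≤-refl
  ; deck-newPos  = refl
  ; unseen       = λ { (suc zero) (s≤s ()) ; (suc (suc x)) _ → refl }
  ; count≤m      = λ { zero → z≤n ; (suc zero) → ≤-refl ; (suc (suc x)) → z≤n }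
  ; count<m      = λ { (suc zero) _ _ → s≤s z≤n ; (suc (suc i)) _ (s≤s ()) }
  ; seen         = λ { (suc zero) _ _ → ≤-refl ; (suc (suc x)) _ (s≤s ()) }
  ; m≤card+count = λ { (suc zero) _ _ → s≤s z≤n ; (suc (suc x)) _ (s≤s ()) }
  ; tight-ahead  = λ { (suc zero) _ _ () ; (suc (suc x)) _ (s≤s ()) }
  ; front-loose  = ≤-refl
  ; total        = refl
  ; front-bound  = ≤-refl
  ; queue-bound  = λ { (suc i) _ () }
  }

module Transition {s : State} {m t : ℕ} (I : Invariant s m t) where
  open Invariant I
  open Arrangement arranged

  next : ℕ
  next = deck (step s) 0

  frontCount≤m : frontCount s ≤ m
  frontCount≤m = count≤m (deck s 0)

  front≤m : deck s 0 ≤ m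
  front≤m = ≤-pred (≤∧≢⇒< (proj₂ (bounded 0 z≤n)) front≢new)
    where
    front≢new : deck s 0 ≢ suc m
    front≢new e = <⇒≢ 1≤newPos (injective (trans e (sym deck-newPos)))

  next≡ : next ≡ deck s 1
  next≡ = trans (deck-step s 0) (cong (deck s) (source-< (seen _ (proj₁ (bounded 0 z≤n)) front≤m)))

  count-step-behind : ∀ i → 1 ≤ i → count (step s) (deck (step s) i) ≡ count s (deck (step s) i)
  count-step-behind i 1≤i = count-step-other s (<⇒≢ 1≤i ∘ sym ∘ deck-step-injective s injective)

  tight-behind-front : ∀ x → 1 ≤ x → x ≤ m → x + count s x ≡ m →
                       ∃ λ j → suc j < newPos × deck s (suc j) ≡ x
  tight-behind-front x 1≤x x≤m tight with tight-ahead x 1≤x x≤m tight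
  ... | suc j , j<p , dj≡x = j , j<p , dj≡x
  ... | zero  , _   , d0≡x = ⊥-elim (<-irrefl (sym tight) (subst (λ y → m < y + count s y) d0≡x front-loose))

  queue-bound-step : ∀ i → 1 ≤ i → 1 ≤ count (step s) (deck (step s) i) →
                     SeenBound (deck (step s) i) (suc (count (step s) (deck (step s) i))) (suc t + i)
  queue-bound-step i 1≤i seen-i rewrite count-step-behind i 1≤i | deck-step s i
    with sourceView (frontCount s) i
  ... | shifted _ e       rewrite e = subst (SeenBound _ _) (+-suc t i) (queue-bound (suc i) (s≤s z≤n) seen-i)
  ... | reinserted refl e rewrite e = subst (SeenBound _ _) (+-suc t _) (seenBound-next {deck s 0} {t = t} front-bound)
  ... | unmoved _ e       rewrite e = seenBound-mono {deck s i} (n≤1+n (t + i)) (queue-bound i 1≤i seen-i)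

  module NextSeen (newPos≢1 : newPos ≢ 1) where
    next-bounded : 1 ≤ next × next ≤ suc m
    next-bounded = subst (λ x → 1 ≤ x × x ≤ suc m) (sym next≡) (bounded 1 (≤-trans 1≤newPos newPos≤m))

    1≤next : 1 ≤ next
    1≤next = proj₁ next-bounded

    next≤m : next ≤ m
    next≤m = ≤-pred (≤∧≢⇒< (proj₂ next-bounded) next≢new)
      where
      next≢new : next ≢ suc m
      next≢new e = newPos≢1 (sym (injective (trans (sym next≡) (trans e (sym deck-newPos)))))

    next-loose : suc m ≤ next + count (step s) next
    next-loose = begin
      suc m                          ≤⟨ s≤s (m≤card+count next 1≤next next≤m) ⟩
      suc (next + count s next)      ≡⟨ sym (+-suc next _) ⟩
      next + suc (count s next)      ≡⟨ cong (next +_) (sym (count-step-front s)) ⟩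
      next + count (step s) next     ∎
      where open ≤-Reasoning

    count≤m′ : ∀ x → count (step s) x ≤ m
    count≤m′ x with x ≟ next
    ... | yes refl = subst (_≤ m) (sym (count-step-front s))
                       (subst (λ y → count s y < m) (sym next≡) (count<m 1 ≤-refl 1≤newPos))
    ... | no x≢    = subst (_≤ m) (sym (count-step-other s x≢)) (count≤m x)

    count<m′ : ∀ i → 1 ≤ i → i ≤ target (frontCount s) newPos → count (step s) (deck (step s) i) < m
    count<m′ i 1≤i i≤ rewrite count-step-behind i 1≤i | deck-step s i with i ≟ frontCount s
    ... | yes refl rewrite source-≡ (frontCount s) = <-≤-trans (≤-target⇒< _ 1≤newPos i≤) newPos≤m
    ... | no i≢k = count<m _ (source-pos 1≤i i≢k) (≤-target⇒source≤ _ 1≤newPos i≤ i≢k)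

    tight-ahead′ : ∀ x → 1 ≤ x → x ≤ m → x + count (step s) x ≡ m →
                   ∃ λ i → i < target (frontCount s) newPos × deck (step s) i ≡ x
    tight-ahead′ x 1≤x x≤m tight with x ≟ next
    ... | yes refl = ⊥-elim (<-irrefl (sym tight) next-loose)
    ... | no x≢ with tight-behind-front x 1≤x x≤m (trans (cong (x +_) (sym (count-step-other s x≢))) tight)
    ...   | j , j<p , dj≡x = target _ (suc j) , target-mono _ (s≤s z≤n) j<p , trans (deck-step-target s (suc j)) dj≡x

    front-bound′ : SeenBound next (count (step s) next) (suc t)
    front-bound′ rewrite count-step-front s =
      subst (λ x → SeenBound x (suc (count s x)) (suc t)) (sym next≡)
        (subst (SeenBound _ _) (+-comm t 1) (queue-bound 1 ≤-refl (subst (λ x → 1 ≤ count s x) next≡ seen-next)))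
      where
      seen-next : 1 ≤ count s next
      seen-next = seen next 1≤next next≤m

    invariant : Invariant (step s) m (suc t)
    invariant = record
      { arranged     = arrangement-step {s} arranged frontCount≤m
      ; newPos       = target (frontCount s) newPos
      ; 1≤newPos     = target-pos _ (≤∧≢⇒< 1≤newPos (newPos≢1 ∘ sym))
      ; newPos≤m     = ≤-trans (target-≤ _ 1≤newPos) newPos≤m
      ; deck-newPos  = trans (deck-step-target s newPos) deck-newPos
      ; unseen       = λ x m<x → trans (count-step-other s (λ x≡ → <⇒≱ m<x (subst (_≤ m) (sym x≡) next≤m)))
                                       (unseen x m<x)
      ; count≤m      = count≤m′
      ; count<m      = count<m′
      ; seen         = λ x 1≤x x≤m → ≤-trans (seen x 1≤x x≤m) (count-step-≥ s x)
      ; m≤card+count = λ x 1≤x x≤m → ≤-trans (m≤card+count x 1≤x x≤m) (+-monoʳ-≤ x (count-step-≥ s x))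
      ; tight-ahead  = tight-ahead′
      ; front-loose  = next-loose
      ; total        = trans (sumTo-increment m 1≤next next≤m (count-step-front s) (λ _ → count-step-other s))
                             (cong suc total)
      ; front-bound  = front-bound′
      ; queue-bound  = queue-bound-step
      }

  module NextNew (newPos≡1 : newPos ≡ 1) where
    next≡new : next ≡ suc m
    next≡new = trans next≡ (trans (cong (deck s) (sym newPos≡1)) deck-newPos)

    count-new : count (step s) (suc m) ≡ 1
    count-new = trans (subst (λ x → count (step s) x ≡ suc (count s x)) next≡new (count-step-front s))
                      (cong suc (unseen (suc m) ≤-refl))

    count-old : ∀ x → x ≤ m → count (step s) x ≡ count s x
    count-old x x≤m = count-step-other s (λ x≡ → <⇒≢ (s≤s x≤m) (trans x≡ next≡new))

    at-next : ∀ (P : ℕ → ℕ → Set) → P (suc m) 1 → P next (count (step s) next)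
    at-next P p = subst (λ x → P x (count (step s) x)) (sym next≡new) (subst (P (suc m)) (sym count-new) p)

    m<card+count : ∀ x → 1 ≤ x → x ≤ m → suc m ≤ x + count s x
    m<card+count x 1≤x x≤m with m≤n⇒m<n∨m≡n (m≤card+count x 1≤x x≤m)
    ... | inj₁ m<  = m<
    ... | inj₂ m≡ with tight-behind-front x 1≤x x≤m (sym m≡)
    ...   | _ , j<p , _ = ⊥-elim (<⇒≱ j<p (≤-trans (≤-reflexive newPos≡1) (s≤s z≤n)))

    m[m+1]≤2t : m * suc m ≤ 2 * t
    m[m+1]≤2t = +-cancelʳ-≤ (m * suc m) _ _ (begin
      m * suc m + m * suc m              ≡⟨ solve (m ∷ []) ⟩
      2 * suc m * m                      ≤⟨ sumTo-≥ m (λ x 1≤x x≤m → subst (suc m ≤_) (+-comm x _)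
                                                                         (m<card+count x 1≤x x≤m)) ⟩
      2 * sumTo m (count s) + m * suc m  ≡⟨ cong (λ S → 2 * S + m * suc m) total ⟩
      2 * t + m * suc m                  ∎)
      where open ≤-Reasoning

    seen′ : ∀ x → 1 ≤ x → x ≤ suc m → 1 ≤ count (step s) x
    seen′ x 1≤x x≤m+1 with m≤n⇒m<n∨m≡n x≤m+1
    ... | inj₁ x≤m = ≤-trans (seen x 1≤x (≤-pred x≤m)) (count-step-≥ s x)
    ... | inj₂ refl = ≤-reflexive (sym count-new)

    m<card+count′ : ∀ x → 1 ≤ x → x ≤ suc m → suc m ≤ x + count (step s) x
    m<card+count′ x 1≤x x≤m+1 with m≤n⇒m<n∨m≡n x≤m+1
    ... | inj₁ x≤m = subst (λ c → suc m ≤ x + c) (sym (count-old x (≤-pred x≤m)))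
                           (m<card+count x 1≤x (≤-pred x≤m))
    ... | inj₂ refl = m≤m+n (suc m) _

    invariant : Invariant (step s) (suc m) (suc t)
    invariant = record
      { arranged     = arrangement-suc (arrangement-step {s} arranged frontCount≤m)
      ; newPos       = suc m
      ; 1≤newPos     = s≤s z≤n
      ; newPos≤m     = ≤-refl
      ; deck-newPos  = Arrangement.beyond (arrangement-step {s} arranged frontCount≤m) (suc m) ≤-refl
      ; unseen       = λ x m+1<x → trans (count-step-other s (λ x≡ → <⇒≢ m+1<x (sym (trans x≡ next≡new))))
                                         (unseen x (<-trans (n<1+n m) m+1<x))
      ; count≤m      = λ x → ≤-trans (count-step-≤ s x) (s≤s (count≤m x))
      ; count<m      = λ i 1≤i _ → subst (_< suc m) (sym (count-step-behind i 1≤i)) (s≤s (count≤m _))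
      ; seen         = seen′
      ; m≤card+count = m<card+count′
      ; tight-ahead  = λ x 1≤x x≤m+1 _ → let (j , j≤m , dj≡x) = onto x 1≤x x≤m+1 in
                         target _ j , s≤s (target-bounded j≤m frontCount≤m) , trans (deck-step-target s j) dj≡x
      ; front-loose  = at-next (λ x c → suc (suc m) ≤ x + c) (≤-reflexive (+-comm 1 (suc m)))
      ; total        = trans (cong₂ _+_ (trans (sumTo-cong m (λ x _ → count-old x)) total) count-new) (+-comm t 1)
      ; front-bound  = at-next (λ x c → SeenBound x c (suc t)) (seenBound-first m[m+1]≤2t)
      ; queue-bound  = queue-bound-step
      }

invariant-step : ∀ {s m t} → Invariant s m t → ∃ λ m′ → Invariant (step s) m′ (suc t)
invariant-step I with Invariant.newPos I ≟ 1
... | yes newPos≡1 = _ , Transition.NextNew.invariant I newPos≡1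
... | no  newPos≢1 = _ , Transition.NextSeen.invariant I newPos≢1

invariant-reachable : ∀ i → ∃ λ m → Invariant (stateAt i) m (suc i)
invariant-reachable zero    = 1 , invariant-initial
invariant-reachable (suc i) = invariant-step (proj₂ (invariant-reachable i))

n*n≤2t+n⇒n*d<t : ∀ {n t} d → 1 ≤ n → n * n ≤ 2 * t + n → (2 * d + 1) * d < t → n * d < t
n*n≤2t+n⇒n*d<t {n} {t} d 1≤n n²≤ [2d+1]d<t with n * d <? t
... | yes nd<t = nd<t
... | no nd≮t = ⊥-elim (<⇒≱ [2d+1]d<t (≤-trans t≤nd (*-monoˡ-≤ d n≤2d+1)))
  where
  open ≤-Reasoning
  instance _ = >-nonZero 1≤n
  t≤nd : t ≤ n * d
  t≤nd = ≮⇒≥ nd≮t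
  n≤2d+1 : n ≤ 2 * d + 1
  n≤2d+1 = *-cancelˡ-≤ n (begin
    n * n           ≤⟨ n²≤ ⟩
    2 * t + n       ≤⟨ +-monoˡ-≤ n (*-monoʳ-≤ 2 t≤nd) ⟩
    2 * (n * d) + n ≡⟨ solve (n ∷ d ∷ []) ⟩
    n * (2 * d + 1) ∎)

*d<[2d+1+b]*t : ∀ {A n t} d b → A ≤ 2 * t + n → n * d < t → A * d < (2 * d + suc b) * t
*d<[2d+1+b]*t {A} {n} {t} d b A≤ nd<t = begin-strict
  A * d                 ≤⟨ *-monoˡ-≤ d A≤ ⟩
  (2 * t + n) * d       ≡⟨ *-distribʳ-+ d (2 * t) n ⟩
  2 * t * d + n * d     <⟨ +-monoʳ-< (2 * t * d) nd<t ⟩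
  2 * t * d + t         ≤⟨ +-monoʳ-≤ (2 * t * d) (m≤m+n t (b * t)) ⟩
  2 * t * d + (t + b * t) ≡⟨ solve (t ∷ d ∷ b ∷ []) ⟩
  (2 * d + suc b) * t   ∎
  where open ≤-Reasoning

ℕ→ℚᵘ : ℕ → ℚᵘ.ℚᵘ
ℕ→ℚᵘ n = mkℚᵘ (ℤ.+ n) 0

toℚᵘ-ℕ→ℚ : ∀ n → toℚᵘ (ℕ→ℚ n) ≡ ℕ→ℚᵘ n
toℚᵘ-ℕ→ℚ n = cong toℚᵘ (ℚₚ.normalize-coprime (Coprime.sym (1-coprimeTo n)))

<ᵘ-clearDenominator : ∀ A B t a d → A * suc d < (B * suc d + suc a) * t →
                      ℕ→ℚᵘ A ℚᵘ.< (ℕ→ℚᵘ B ℚᵘ.+ mkℚᵘ (ℤ.+ suc a) d) ℚᵘ.* ℕ→ℚᵘ t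
<ᵘ-clearDenominator A B t a d lt = ℚᵘ.*<* (subst₂ ℤ._<_ lhs rhs (+<+ lt))
  where
  q = (ℕ→ℚᵘ B ℚᵘ.+ mkℚᵘ (ℤ.+ suc a) d) ℚᵘ.* ℕ→ℚᵘ t
  lhs : ℤ.+ (A * suc d) ≡ ℤ.+ A ℤ.* ℚᵘ.↧ q
  lhs rewrite *-identityʳ (d + 0) | +-identityʳ d = ℤₚ.pos-* A (suc d)
  rhs : ℤ.+ ((B * suc d + suc a) * t) ≡ ℚᵘ.↥ q ℤ.* ℤ.+ 1
  rhs rewrite ℤₚ.*-identityʳ (ℚᵘ.↥ q) | ℤₚ.+◃n≡+n (B * suc d) | *-identityʳ a = sym (ℤₚ.+◃n≡+n _)

ℕ→ℚ-<-clearDenominator : ∀ A B t a d .(c : Coprime (suc a) (suc d)) → A * suc d < (B * suc d + suc a) * t →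
                         ℕ→ℚ A <ℚ (ℕ→ℚ B +ℚ mkℚ (ℤ.+ suc a) d c) *ℚ ℕ→ℚ t
ℕ→ℚ-<-clearDenominator A B t a d c lt = ℚₚ.toℚᵘ-cancel-<
  (subst (ℚᵘ._< _) (sym (toℚᵘ-ℕ→ℚ A))
    (ℚᵘₚ.<-respʳ-≃ (ℚᵘₚ.≃-sym toℚᵘ-rhs) (<ᵘ-clearDenominator A B t a d lt)))
  where
  ε = mkℚ (ℤ.+ suc a) d c
  toℚᵘ-rhs : toℚᵘ ((ℕ→ℚ B +ℚ ε) *ℚ ℕ→ℚ t) ℚᵘ.≃ (ℕ→ℚᵘ B ℚᵘ.+ toℚᵘ ε) ℚᵘ.* ℕ→ℚᵘ t
  toℚᵘ-rhs = ℚᵘₚ.≃-trans (ℚₚ.toℚᵘ-homo-* (ℕ→ℚ B +ℚ ε) (ℕ→ℚ t))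
    (ℚᵘₚ.≃-trans (ℚᵘₚ.*-congʳ (ℚₚ.toℚᵘ-homo-+ (ℕ→ℚ B) ε))
      (ℚᵘₚ.≃-reflexive (cong₂ (λ x y → (x ℚᵘ.+ toℚᵘ ε) ℚᵘ.* y) (toℚᵘ-ℕ→ℚ B) (toℚᵘ-ℕ→ℚ t))))

seenAt-front : ∀ {n k t} (P : ℕ → ℕ → Set) → SeenAt n k (suc t) →
               P (deck (stateAt t) 0) (frontCount (stateAt t)) → P n k
seenAt-front {t = t} P (front≡n , count≡k) = subst₂ P front≡n (trans (cong (count (stateAt t)) front≡n) count≡k)

seenAt-time-< : ∀ {n k t} → t ≥ 1 → SeenAt n k t → t < (n + k) * (n + k)
seenAt-time-< {n} {k} {suc t} _ T≡t = begin-strict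
  suc t                       ≡⟨ sym total ⟩
  sumTo m (count (stateAt t)) ≤⟨ sumTo-≤ m count≤m ⟩
  m * m                       <⟨ *-mono-< m<n+k m<n+k ⟩
  (n + k) * (n + k)           ∎
  where
  open ≤-Reasoning
  m = proj₁ (invariant-reachable t)
  open Invariant (proj₂ (invariant-reachable t))
  m<n+k : m < n + k
  m<n+k = seenAt-front {t = t} (λ x c → suc m ≤ x + c) T≡t front-loose

seenAt-squares-≤ : ∀ {n k t} → t ≥ 1 → SeenAt n k t → n * n + k * k ≤ 2 * t + n
seenAt-squares-≤ {n} {k} {suc t} _ T≡t =
  ≤-trans (m≤m+n (n * n + k * k) k)
    (seenAt-front {t = t} (λ x c → SeenBound x c (suc t)) T≡t (Invariant.front-bound (proj₂ (invariant-reachable t))))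

seenAt-squares-<-2+ε : ∀ (ε : ℚ) → 0ℚ <ℚ ε → ∃ λ (M : ℕ) →
                       ∀ n k t → n ≥ 1 → k ≥ 1 → t ≥ 1 → SeenAt n k t → t ≥ M →
                       ℕ→ℚ (n * n + k * k) <ℚ (ℕ→ℚ 2 +ℚ ε) *ℚ ℕ→ℚ t
seenAt-squares-<-2+ε (mkℚ (ℤ.+ 0)      _ _) (*<* (+<+ ()))
seenAt-squares-<-2+ε (mkℚ -[1+ _ ]   _ _) (*<* ())
seenAt-squares-<-2+ε (mkℚ (ℤ.+ suc a)  d c) _ = suc ((2 * suc d + 1) * suc d) , λ n k t 1≤n _ t≥1 T≡t t≥M →
  let squares≤ = seenAt-squares-≤ t≥1 T≡t in
  ℕ→ℚ-<-clearDenominator (n * n + k * k) 2 t a d c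
    (*d<[2d+1+b]*t (suc d) a squares≤ (n*n≤2t+n⇒n*d<t (suc d) 1≤n (≤-trans (m≤m+n _ _) squares≤) t≥M))

mainTheorem10 : (∀ n k t → n ≥ 1 → k ≥ 1 → t ≥ 1 → SeenAt n k t → t < (n + k) * (n + k))
    × (∀ (ε : ℚ) → 0ℚ <ℚ ε → ∃ λ (M : ℕ) → ∀ n k t → n ≥ 1 → k ≥ 1 → t ≥ 1 → SeenAt n k t → t ≥ M →
        ℕ→ℚ (n * n + k * k) <ℚ (ℕ→ℚ 2 +ℚ ε) *ℚ ℕ→ℚ t)
mainTheorem10 = (λ _ _ _ _ _ t≥1 T≡t → seenAt-time-< t≥1 T≡t) , seenAt-squares-<-2+ε
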